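{- Let $\Gamma$ be a strongly connected simple digraph with diameter $D$ that contains a (directed) cycle of odd length, and let $g_o(\Gamma)$ be its odd-girth. Then $g_o(\Gamma)\leq 2D+1$.
   Context: A simple digraph has no loops or multiple arcs (both $(u,v)$ and $(v,u)$ may be arcs); walks, paths and cycles are directed, and "connected" means strongly connected. The diameter $D$ is the maximum directed distance between vertices. The odd-girth $g_o(\Gamma)$ is the smallest length of a directed cycle of odd length. -}

module Defs where

open import Data.Nat using (ℕ; zero; suc; _≤_; _<_; _+_; _*_)
open import Data.Fin using (Fin)
open import Data.List using (List; []; _∷_; length; _++_)
open import Data.List.Relation.Unary.Unique.Propositional using (Unique)
open import Data.Product using (Σ; _×_; ∃; ∃-syntax; _,_)
open import Relation.Binary.PropositionalEquality using (_≡_)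
open import Relation.Nullary using (¬_)

Odd : ℕ → Set
Odd ℓ = ∃[ k ] (ℓ ≡ 2 * k + 1)

-- A simple digraph on vertex set Fin n: an arc relation with no loops.
-- (Multiple arcs cannot occur since arcs form a relation; both (u,v), (v,u) allowed.)
record Digraph (n : ℕ) : Set₁ where
  field
    Arc     : Fin n → Fin n → Set
    loopless : ∀ v → ¬ Arc v v
open Digraph public

data Walk {n : ℕ} (G : Digraph n) : Fin n → Fin n → ℕ → Set where
  here : ∀ {u} → Walk G u u 0
  step : ∀ {u w v ℓ} → Arc G u w → Walk G w v ℓ → Walk G u v (suc ℓ)

Dist : ∀ {n} → Digraph n → Fin n → Fin n → ℕ → Set
Dist G u v d = Walk G u v d × (∀ ℓ → Walk G u v ℓ → d ≤ ℓ)

StronglyConnected : ∀ {n} → Digraph n → Set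
StronglyConnected G = ∀ u v → ∃[ ℓ ] Walk G u v ℓ

IsDiameter : ∀ {n} → Digraph n → ℕ → Set
IsDiameter G D =
  (∀ u v → ∃[ d ] (Dist G u v d × d ≤ D)) ×
  (∃[ u ] ∃[ v ] Dist G u v D)

data IsPath {n : ℕ} (G : Digraph n) : List (Fin n) → Set where
  single : ∀ v → IsPath G (v ∷ [])
  cons   : ∀ {u v vs} → Arc G u v → IsPath G (v ∷ vs) → IsPath G (u ∷ v ∷ vs)

-- Directed cycle of length ℓ: distinct vertices v₀ ∷ v₁ ∷ … ∷ v_{ℓ-1} (ℓ ≥ 2, since
-- there are no loops) with arcs v₀→v₁→…→v_{ℓ-1}→v₀.
IsCycle : ∀ {n} → Digraph n → ℕ → Set
IsCycle {n} G ℓ =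
  Σ (Fin n) λ v₀ → Σ (List (Fin n)) λ vs →
    (length (v₀ ∷ vs) ≡ ℓ) × (2 ≤ ℓ) × Unique (v₀ ∷ vs) × IsPath G (v₀ ∷ vs ++ v₀ ∷ [])

IsOddGirth : ∀ {n} → Digraph n → ℕ → Set
IsOddGirth G g =
  (Odd g × IsCycle G g) × (∀ ℓ → Odd ℓ → IsCycle G ℓ → g ≤ ℓ)

HasOddCycle : ∀ {n} → Digraph n → Set
HasOddCycle G = ∃[ ℓ ] (Odd ℓ × IsCycle G ℓ)

-- An odd closed walk cannot alternate the parity of d(·, v) along each of its arcs, so it
-- has an arc x → y with d(x, v) ≡ d(y, v) (mod 2). Going from v to x and back to v either
-- directly or through the arc x → y gives two closed walks of length at most 2D + 1 whose
-- lengths differ by one; the odd one contains an odd cycle that is no longer.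
module Submission where

open import Defs
open import Data.Nat using (ℕ; suc; _≤_; _<_; _+_; _*_; z≤n; s≤s; z<s; parity)
open import Data.Nat.Properties
  using (≤-refl; ≤-trans; <⇒≤; <-≤-trans; m≤n+m; m<m+n; +-mono-≤; +-monoˡ-≤; +-monoʳ-≤; +-monoˡ-<;
         +-comm; +-suc; n≤1+n)
open import Data.Nat.Induction using (<-rec)
open import Data.Nat.Tactic.RingSolver using (solve-∀)
open import Data.Parity using (Parity; 0ℙ; 1ℙ; _⁻¹) renaming (_+_ to _⊕_)
open import Data.Parity.Properties
  using (p≢p⁻¹; +-homo-+; *-homo-*) renaming (_≟_ to _≟ℙ_; +-assoc to ⊕-assoc; +-comm to ⊕-comm)
open import Data.Fin using (Fin) renaming (_≟_ to _≟F_)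
open import Data.List using (List; []; _∷_; length; _++_)
open import Data.List.Membership.Propositional using (_∈_)
open import Data.List.Relation.Unary.Any using (here; there)
open import Data.List.Relation.Unary.All.Properties using (¬Any⇒All¬)
open import Data.List.Relation.Unary.AllPairs using ([]; _∷_)
open import Data.List.Relation.Unary.Unique.Propositional using (Unique)
open import Data.Product using (Σ; ∃₂; ∃-syntax; _×_; _,_; proj₁)
open import Data.Sum using (_⊎_; inj₁; inj₂)
open import Data.Empty using (⊥-elim)
open import Relation.Nullary using (yes; no)
open import Relation.Binary.PropositionalEquality
  using (_≡_; _≢_; refl; sym; trans; cong; subst; module ≡-Reasoning)

odd⇒parity≡1ℙ : ∀ {ℓ} → Odd ℓ → parity ℓ ≡ 1ℙ
odd⇒parity≡1ℙ (k , refl) = trans (+-homo-+ (2 * k) 1) (cong (_⊕ 1ℙ) (*-homo-* 2 k))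

parity≡1ℙ⇒odd : ∀ {ℓ} → parity ℓ ≡ 1ℙ → Odd ℓ
parity≡1ℙ⇒odd {1} _ = 0 , refl
parity≡1ℙ⇒odd {suc (suc ℓ)} p with parity≡1ℙ⇒odd {ℓ} p
... | k , refl = suc k , cong suc (cong (_+ 1) (sym (+-suc k (k + 0))))

≢⇒≡⁻¹ : ∀ {p q} → p ≢ q → q ≡ p ⁻¹
≢⇒≡⁻¹ {0ℙ} {0ℙ} p≢q = ⊥-elim (p≢q refl)
≢⇒≡⁻¹ {0ℙ} {1ℙ} _   = refl
≢⇒≡⁻¹ {1ℙ} {0ℙ} _   = refl
≢⇒≡⁻¹ {1ℙ} {1ℙ} p≢q = ⊥-elim (p≢q refl)

⊕≡1ℙ⇒ : ∀ p q → p ⊕ q ≡ 1ℙ → p ≡ 1ℙ ⊎ q ≡ 1ℙ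
⊕≡1ℙ⇒ 0ℙ q eq = inj₂ eq
⊕≡1ℙ⇒ 1ℙ q eq = inj₁ refl

parity-+-+≡1ℙ⇒ : ∀ a b c → parity (a + b + c) ≡ 1ℙ → parity b ≡ 1ℙ ⊎ parity (a + c) ≡ 1ℙ
parity-+-+≡1ℙ⇒ a b c eq = ⊕≡1ℙ⇒ (parity b) (parity (a + c)) (begin
  parity b ⊕ parity (a + c) ≡⟨ +-homo-+ b (a + c) ⟨
  parity (b + (a + c))      ≡⟨ cong parity (b+[a+c]≡a+b+c a b c) ⟩
  parity (a + b + c)        ≡⟨ eq ⟩
  1ℙ                        ∎)
  where
  open ≡-Reasoning
  b+[a+c]≡a+b+c : ∀ a b c → b + (a + c) ≡ a + b + c
  b+[a+c]≡a+b+c = solve-∀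

parity-+-or-+-suc≡1ℙ : ∀ a {p q} → parity p ≡ parity q →
                       parity (a + p) ≡ 1ℙ ⊎ parity (a + suc q) ≡ 1ℙ
parity-+-or-+-suc≡1ℙ a {p} {q} p≡q with parity (a + p) ≟ℙ 1ℙ
... | yes odd = inj₁ odd
... | no even = inj₂ (begin
  parity (a + suc q)             ≡⟨ cong parity (+-comm a (suc q)) ⟩
  parity (1 + (q + a))           ≡⟨ +-homo-+ 1 (q + a) ⟩
  1ℙ ⊕ parity (q + a)            ≡⟨ cong (1ℙ ⊕_) (+-homo-+ q a) ⟩
  1ℙ ⊕ (parity q ⊕ parity a)     ≡⟨ cong (λ r → 1ℙ ⊕ (r ⊕ parity a)) p≡q ⟨
  1ℙ ⊕ (parity p ⊕ parity a)     ≡⟨ cong (1ℙ ⊕_) (+-homo-+ p a) ⟨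
  parity (p + a) ⁻¹              ≡⟨ cong (λ r → parity r ⁻¹) (+-comm p a) ⟩
  parity (a + p) ⁻¹              ≡⟨ ≢⇒≡⁻¹ even ⟨
  1ℙ                             ∎)
  where open ≡-Reasoning

m+suc-n≤2o+1 : ∀ {m n o} → m ≤ o → n ≤ o → m + suc n ≤ 2 * o + 1
m+suc-n≤2o+1 {m} {n} {o} m≤o n≤o = subst (m + suc n ≤_) (o+suc-o≡2o+1 o) (+-mono-≤ m≤o (s≤s n≤o))
  where
  o+suc-o≡2o+1 : ∀ o → o + suc o ≡ 2 * o + 1
  o+suc-o≡2o+1 = solve-∀

m+n≤2o+1 : ∀ {m n o} → m ≤ o → n ≤ o → m + n ≤ 2 * o + 1
m+n≤2o+1 {m} m≤o n≤o = ≤-trans (+-monoʳ-≤ m (n≤1+n _)) (m+suc-n≤2o+1 m≤o n≤o)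

module _ {n : ℕ} (G : Digraph n) where

  open import Data.List.Membership.DecPropositional (_≟F_ {n}) using (_∈?_)

  infixr 5 _++ʷ_

  _++ʷ_ : ∀ {x y z a b} → Walk G x y a → Walk G y z b → Walk G x z (a + b)
  here     ++ʷ q = q
  step e p ++ʷ q = step e (p ++ʷ q)

  -- The tails of the arcs of a walk: the final vertex is not listed.
  tails : ∀ {x y a} → Walk G x y a → List (Fin n)
  tails here           = []
  tails {x} (step _ p) = x ∷ tails p

  length-tails : ∀ {x y a} (w : Walk G x y a) → length (tails w) ≡ a
  length-tails here       = refl
  length-tails (step _ p) = cong suc (length-tails p)

  tails-isPath : ∀ {x y a} (w : Walk G x y a) → IsPath G (tails w ++ y ∷ [])
  tails-isPath {y = y} here        = single y
  tails-isPath (step e here)       = cons e (single _)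
  tails-isPath (step e (step f p)) = cons e (tails-isPath (step f p))

  isPath⇒walk : ∀ {x y} (xs : List (Fin n)) → IsPath G (x ∷ xs ++ y ∷ []) →
                Walk G x y (suc (length xs))
  isPath⇒walk []       (cons e (single _)) = step e here
  isPath⇒walk (_ ∷ xs) (cons e p)          = step e (isPath⇒walk xs p)

  cycle⇒closedWalk : ∀ {ℓ} → IsCycle G ℓ → ∃[ v ] Walk G v v ℓ
  cycle⇒closedWalk (v , vs , refl , _ , _ , path) = v , isPath⇒walk vs path

  split-at-tail : ∀ {x y a z} (w : Walk G x y a) → z ∈ tails w →
                  ∃₂ λ b c → Walk G x z b × Walk G z y (suc c) × b + suc c ≡ a
  split-at-tail (step e p) (here refl) = 0 , _ , here , step e p , refl
  split-at-tail (step e p) (there z∈) with split-at-tail p z∈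
  ... | b , c , p₁ , p₂ , refl = suc b , c , step e p₁ , p₂ , refl

  -- The last segment is nonempty, so both the loop and the rest are shorter than the walk.
  Detour : Fin n → Fin n → ℕ → Set
  Detour x y a = Σ (Fin n) λ z → ∃[ b ] ∃[ k ] ∃[ c ]
    Walk G x z b × Walk G z z (suc k) × Walk G z y (suc c) × b + suc k + suc c ≡ a

  uniqueTails-or-detour : ∀ {x y a} (w : Walk G x y a) → Unique (tails w) ⊎ Detour x y a
  uniqueTails-or-detour here = inj₁ []
  uniqueTails-or-detour {x} (step e p) with uniqueTails-or-detour p
  ... | inj₂ (z , b , k , c , p₁ , loop , p₂ , refl) =
    inj₂ (z , suc b , k , c , step e p₁ , loop , p₂ , refl)
  ... | inj₁ unique with x ∈? tails p
  ...   | no  x∉ = inj₁ (¬Any⇒All¬ _ x∉ ∷ unique)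
  ...   | yes x∈ with split-at-tail p x∈
  ...     | b , c , p₁ , p₂ , refl = inj₂ (x , 0 , b , c , here , step e p₁ , p₂ , refl)

  oddUniqueClosedWalk⇒cycle : ∀ {v L} (w : Walk G v v L) → parity L ≡ 1ℙ → Unique (tails w) →
                              IsCycle G L
  oddUniqueClosedWalk⇒cycle {v} (step e here) _ _ = ⊥-elim (loopless G v e)
  oddUniqueClosedWalk⇒cycle {v} (step e (step f p)) _ unique =
    v , tails (step f p) , cong suc (length-tails (step f p)) , s≤s (s≤s z≤n) , unique ,
    tails-isPath (step e (step f p))

  OddCycleWithin : ℕ → Set
  OddCycleWithin L = ∃[ ℓ ] (Odd ℓ × IsCycle G ℓ × ℓ ≤ L)

  oddCycleWithin-mono : ∀ {L M} → L ≤ M → OddCycleWithin L → OddCycleWithin M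
  oddCycleWithin-mono L≤M (ℓ , odd , cycle , ℓ≤L) = ℓ , odd , cycle , ≤-trans ℓ≤L L≤M

  -- Cutting out a loop splits an odd closed walk into two shorter closed walks, one of them odd.
  oddClosedWalk⇒oddCycle : ∀ L {v} → Walk G v v L → parity L ≡ 1ℙ → OddCycleWithin L
  oddClosedWalk⇒oddCycle = <-rec _ shorten
    where
    shorten : ∀ L → (∀ {M} → M < L → ∀ {v} → Walk G v v M → parity M ≡ 1ℙ → OddCycleWithin M) →
              ∀ {v} → Walk G v v L → parity L ≡ 1ℙ → OddCycleWithin L
    shorten L rec w odd with uniqueTails-or-detour w
    ... | inj₁ unique = L , parity≡1ℙ⇒odd odd , oddUniqueClosedWalk⇒cycle w odd unique , ≤-refl
    ... | inj₂ (_ , b , k , c , p₁ , loop , p₂ , refl) with parity-+-+≡1ℙ⇒ b (suc k) (suc c) odd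
    ...   | inj₁ odd-loop = oddCycleWithin-mono (<⇒≤ loop<) (rec loop< loop odd-loop)
      where
      loop< : suc k < b + suc k + suc c
      loop< = <-≤-trans (m<m+n (suc k) z<s) (+-monoˡ-≤ (suc c) (m≤n+m (suc k) b))
    ...   | inj₂ odd-rest = oddCycleWithin-mono (<⇒≤ rest<) (rec rest< (p₁ ++ʷ p₂) odd-rest)
      where
      rest< : b + suc c < b + suc k + suc c
      rest< = +-monoˡ-< (suc c) (m<m+n b z<s)

  parityAlternates-or-monochromaticArc : (f : Fin n → Parity) → ∀ {x y m} → Walk G x y m →
    (∃₂ λ x′ y′ → Arc G x′ y′ × f x′ ≡ f y′) ⊎ f y ≡ parity m ⊕ f x
  parityAlternates-or-monochromaticArc f here = inj₂ refl
  parityAlternates-or-monochromaticArc f {x} {y} {suc m} (step {w = w} e p) with f x ≟ℙ f w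
  ... | yes fx≡fw = inj₁ (x , w , e , fx≡fw)
  ... | no  fx≢fw with parityAlternates-or-monochromaticArc f p
  ...   | inj₁ arc  = inj₁ arc
  ...   | inj₂ fy≡m⊕fw = inj₂ (begin
    f y                       ≡⟨ fy≡m⊕fw ⟩
    parity m ⊕ f w            ≡⟨ cong (parity m ⊕_) (≢⇒≡⁻¹ fx≢fw) ⟩
    parity m ⊕ (1ℙ ⊕ f x)     ≡⟨ ⊕-assoc (parity m) 1ℙ (f x) ⟨
    parity m ⊕ 1ℙ ⊕ f x       ≡⟨ cong (_⊕ f x) (⊕-comm (parity m) 1ℙ) ⟩
    1ℙ ⊕ parity m ⊕ f x       ≡⟨ cong (_⊕ f x) (+-homo-+ 1 m) ⟨
    parity (suc m) ⊕ f x      ∎)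
    where open ≡-Reasoning

  oddClosedWalk⇒monochromaticArc : (f : Fin n → Parity) → ∀ {v L} → Walk G v v L → parity L ≡ 1ℙ →
                                   ∃₂ λ x y → Arc G x y × f x ≡ f y
  oddClosedWalk⇒monochromaticArc f {v} w odd with parityAlternates-or-monochromaticArc f w
  ... | inj₁ arc = arc
  ... | inj₂ fv≡L⊕fv = ⊥-elim (p≢p⁻¹ (f v) (trans fv≡L⊕fv (cong (_⊕ f v) odd)))

  BoundedDistances : ℕ → Set
  BoundedDistances D = ∀ u v → ∃[ d ] (Walk G u v d × d ≤ D)

  shortOddClosedWalk : ∀ {D} → BoundedDistances D → ∀ {v L} → Walk G v v L → parity L ≡ 1ℙ →
                       ∃[ M ] (Walk G v v M × M ≤ 2 * D + 1 × parity M ≡ 1ℙ)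
  shortOddClosedWalk bounded {v} w odd
    with oddClosedWalk⇒monochromaticArc (λ x → parity (proj₁ (bounded x v))) w odd
  ... | x , y , e , dx≡dy
    with bounded v x | bounded x v | bounded y v
  ... | a , v→x , a≤D | _ , x→v , dx≤D | dy , y→v , dy≤D
    with parity-+-or-+-suc≡1ℙ a dx≡dy
  ... | inj₁ odd′ = _ , v→x ++ʷ x→v , m+n≤2o+1 a≤D dx≤D , odd′
  ... | inj₂ odd′ = _ , v→x ++ʷ step e y→v , m+suc-n≤2o+1 a≤D dy≤D , odd′

diameter⇒boundedDistances : ∀ {n} {G : Digraph n} {D} → IsDiameter G D → BoundedDistances G D
diameter⇒boundedDistances (bounded , _) u v with bounded u v
... | d , (w , _) , d≤D = d , w , d≤D

mainTheorem12 : ∀ {n : ℕ} (G : Digraph n) (D g : ℕ) →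
    StronglyConnected G → IsDiameter G D → HasOddCycle G → IsOddGirth G g →
    g ≤ 2 * D + 1
mainTheorem12 G D g _ diameter (ℓ , odd , cycle) (_ , minimal)
  with cycle⇒closedWalk G cycle
... | v , closed
  with shortOddClosedWalk G (diameter⇒boundedDistances diameter) closed (odd⇒parity≡1ℙ odd)
... | M , short , M≤2D+1 , oddM
  with oddClosedWalk⇒oddCycle G M short oddM
... | ℓ′ , odd′ , cycle′ , ℓ′≤M = ≤-trans (minimal ℓ′ odd′ cycle′) (≤-trans ℓ′≤M M≤2D+1)
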